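{- Let $\vec S$ be a submodular separation system in a universe $\vec U$, let $\mathcal F\subseteq2^{\vec S}$ contain $\mathcal P_S$, and let $\mathcal F^*$ be an uncrossing of $\mathcal F$. Then an orientation $O$ of $S$ is a regular $\mathcal F$-tangle if and only if it is a regular $\mathcal F^*$-tangle.
   Context: A separation system is a poset $\vec S$ with an order-reversing involution ${}^*$; write $\overleftarrow s:=\vec s^{\,*}$, a separation is $s=\{\vec s,\overleftarrow s\}$, $S$ the set of separations. A universe $\vec U$ is a separation system that is a lattice (join $\vee$, meet $\wedge$). $\vec S\subseteq\vec U$ (closed under ${}^*$) is submodular if for all $\vec r,\vec s\in\vec S$ at least one of $\vec r\wedge\vec s$, $\vec r\vee\vec s$ lies in $\vec S$. $\mathcal P:=\{\{\vec r,\vec s,\overleftarrow r\wedge\overleftarrow s\}:\vec r,\vec s\in\vec U\}$, $\mathcal P_S:=\mathcal P\cap2^{\vec S}$. An orientation of $S$ is a set $O\subseteq\vec S$ containing exactly one of $\vec s,\overleftarrow s$ for each $s\in S$; it is consistent if there are no distinct $r,s$ with $\vec r<\vec s$ and $\overleftarrow r,\vec s\in O$; regular if it contains every small $\vec s\in\vec S$ (i.e. with $\vec s\le\overleftarrow s$); it avoids a family $\mathcal H$ if no member of $\mathcal H$ is a subset of $O$. An $\mathcal H$-tangle of $S$ is a consistent orientation of $S$ avoiding $\mathcal H$. A separation $s$ is degenerate if $\vec s=\overleftarrow s$; a star is a set $\sigma$ of nondegenerate oriented separations with $\vec r\le\overleftarrow s$ for all distinct $\vec r,\vec s\in\sigma$.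 Uncrossing: for $\sigma\subseteq\vec S$ and $\vec x_1,\vec x_2\in\sigma$, uncrossing $\vec x_1,\vec x_2$ in $\sigma$ replaces $\{\vec x_1,\vec x_2\}$ by $\{\vec x_1\wedge\overleftarrow x_2,\vec x_2\}$ if $\vec x_1\wedge\overleftarrow x_2\in\vec S$, or by $\{\vec x_1,\vec x_2\wedge\overleftarrow x_1\}$ if $\vec x_2\wedge\overleftarrow x_1\in\vec S$. A star $\tau$ is obtained by uncrossing $\sigma$ if it arises from $\sigma$ by a finite sequence of such steps. An uncrossing of $\mathcal F$ is a family $\mathcal F^*$ such that every $\tau\in\mathcal F^*$ is a star obtained by uncrossing some $\sigma\in\mathcal F$, and for every $\sigma\in\mathcal F$ there is $\tau\in\mathcal F^*$ obtained by uncrossing $\sigma$. -}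

module Defs where

open import Level using (Level; _⊔_) renaming (suc to lsuc; zero to 0ℓ)
open import Data.Product using (Σ; ∃; ∃-syntax; _×_; _,_)
open import Data.Sum using (_⊎_)
open import Data.Empty using (⊥)
open import Relation.Nullary using (¬_)
open import Relation.Binary.PropositionalEquality using (_≡_)
open import Relation.Binary.Core using (Rel)
open import Relation.Binary.Lattice.Structures using (IsLattice)

record Universe : Set₁ where
  infixr 7 _∧_
  infixr 6 _∨_
  infix 4 _≤_
  infix 9 _*
  field
    U         : Set
    _≤_       : Rel U 0ℓ
    _∨_       : U → U → U
    _∧_       : U → U → U
    isLattice : IsLattice _≡_ _≤_ _∨_ _∧_
    _*        : U → U
    involutive     : ∀ x → (x *) * ≡ x
    order-reversing : ∀ {x y} → x ≤ y → y * ≤ x *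

module _ (𝕌 : Universe) where
  open Universe 𝕌

  Subset : Set₁
  Subset = U → Set

  _⊆_ : Subset → Subset → Set
  A ⊆ B = ∀ x → A x → B x

  _≐_ : Subset → Subset → Set
  A ≐ B = A ⊆ B × B ⊆ A

  record Family : Set₁ where
    field
      Idx : Set
      mem : Idx → Subset
  open Family public

  ClosedUnder* : Subset → Set
  ClosedUnder* S = ∀ x → S x → S (x *)

  Submodular : Subset → Set
  Submodular S = ∀ r s → S r → S s → S (r ∧ s) ⊎ S (r ∨ s)

  FamilyIn : Subset → Family → Set
  FamilyIn S F = ∀ i → mem F i ⊆ S

  profileSet : U → U → Subset
  profileSet r s x = x ≡ r ⊎ x ≡ s ⊎ x ≡ (r *) ∧ (s *)

  ContainsP : Subset → Family → Set
  ContainsP S F = ∀ r s → profileSet r s ⊆ S →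
                  ∃[ i ] (mem F i ≐ profileSet r s)

  IsOrientation : Subset → Subset → Set
  IsOrientation S O = O ⊆ S
                    × (∀ x → S x → O x ⊎ O (x *))
                    × (∀ x → O x → O (x *) → x ≡ x *)

  Consistent : Subset → Set
  Consistent O = ∀ r s → r ≤ s → ¬ (r ≡ s) → ¬ (r ≡ s *) →
                 O (r *) → O s → ⊥

  Regular : Subset → Subset → Set
  Regular S O = ∀ s → S s → s ≤ s * → O s

  Avoids : Family → Subset → Set
  Avoids H O = ∀ i → ¬ (mem H i ⊆ O)

  RegularTangle : Subset → Family → Subset → Set
  RegularTangle S H O = IsOrientation S O × Consistent O × Avoids H O × Regular S O

  IsStar : Subset → Set
  IsStar σ = (∀ x → σ x → ¬ (x ≡ x *))
           × (∀ r s → σ r → σ s → ¬ (r ≡ s) → r ≤ s *)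

  replace : Subset → U → U → U → U → Subset
  replace σ a b c d y = (σ y × ¬ (y ≡ a) × ¬ (y ≡ b)) ⊎ y ≡ c ⊎ y ≡ d

  UncrossStep : Subset → Subset → Subset → Set
  UncrossStep S σ σ' =
    ∃[ x₁ ] ∃[ x₂ ] (σ x₁ × σ x₂ × ¬ (x₁ ≡ x₂) ×
      ((S (x₁ ∧ x₂ *) × σ' ≐ replace σ x₁ x₂ (x₁ ∧ x₂ *) x₂)
       ⊎ (S (x₂ ∧ x₁ *) × σ' ≐ replace σ x₁ x₂ x₁ (x₂ ∧ x₁ *))))

  data Uncrosses (S : Subset) (σ : Subset) : Subset → Set₁ where
    done : ∀ {τ} → σ ≐ τ → Uncrosses S σ τ
    step : ∀ {ρ τ} → UncrossStep S σ ρ → Uncrosses S ρ τ → Uncrosses S σ τ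

  ObtainedByUncrossing : Subset → Subset → Subset → Set₁
  ObtainedByUncrossing S σ τ = IsStar τ × Uncrosses S σ τ

  IsUncrossingOf : Subset → Family → Family → Set₁
  IsUncrossingOf S F* F =
    (∀ j → ∃[ i ] ObtainedByUncrossing S (mem F i) (mem F* j))
    × (∀ i → ∃[ j ] ObtainedByUncrossing S (mem F i) (mem F* j))

-- An uncrossing step replaces some a ∈ σ by a ∧ b* for another b ∈ σ. A regular
-- consistent orientation is down-closed in S, so it still contains σ after such
-- steps; hence avoiding F* forces avoiding F. Conversely, if O avoids F ⊇ P_S and
-- contains b and a ∧ b*, it contains a, for otherwise it would contain the profile
-- {a*, b, a ∧ b*}; so every uncrossing of σ lying in O forces σ ⊆ O.
module Submission where

open import Defs hiding (_⊆_)
open import Data.Product using (_,_; proj₁; proj₂; ∃-syntax)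
open import Data.Sum using (inj₁; inj₂)
open import Data.Empty using (⊥; ⊥-elim)
open import Relation.Nullary using (¬_)
open import Relation.Binary.PropositionalEquality using (_≡_; refl; sym; subst; cong)
open import Relation.Binary.Lattice.Structures using (IsLattice)
import Relation.Binary.Lattice.Properties.MeetSemilattice as MeetSemilatticeProperties
open import Function.Bundles using (_⇔_; mk⇔)

module _ (𝕌 : Universe) where
  open Universe 𝕌
  open IsLattice isLattice using (isMeetSemilattice; x∧y≤x)

  infix 4 _⊆_
  _⊆_ : Subset 𝕌 → Subset 𝕌 → Set
  _⊆_ = Defs._⊆_ 𝕌

  ∧-idempotent : ∀ x → x ∧ x ≡ x
  ∧-idempotent = MeetSemilatticeProperties.∧-idempotent
    (record { isMeetSemilattice = isMeetSemilattice })

  -- Either kind of uncrossing step, normalised so that a becomes a ∧ b* and b is kept.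
  record Shrinking (S σ ρ : Subset 𝕌) : Set where
    field
      a b     : U
      σa      : σ a
      σb      : σ b
      S-a∧b*  : S (a ∧ b *)
      ρ⊆      : ρ ⊆ replace 𝕌 σ a b (a ∧ b *) b
      ⊆ρ      : replace 𝕌 σ a b (a ∧ b *) b ⊆ ρ

  replace-swap : ∀ {σ a b c d} → replace 𝕌 σ a b c d ⊆ replace 𝕌 σ b a d c
  replace-swap y (inj₁ (σy , y≢a , y≢b)) = inj₁ (σy , y≢b , y≢a)
  replace-swap y (inj₂ (inj₁ y≡c))       = inj₂ (inj₂ y≡c)
  replace-swap y (inj₂ (inj₂ y≡d))       = inj₂ (inj₁ y≡d)

  uncrossStep⇒shrinking : ∀ {S σ ρ} → UncrossStep 𝕌 S σ ρ → Shrinking S σ ρ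
  uncrossStep⇒shrinking (x₁ , x₂ , σx₁ , σx₂ , _ , inj₁ (S-meet , ρ⊆ , ⊆ρ)) =
    record { a = x₁ ; b = x₂ ; σa = σx₁ ; σb = σx₂ ; S-a∧b* = S-meet ; ρ⊆ = ρ⊆ ; ⊆ρ = ⊆ρ }
  uncrossStep⇒shrinking {σ = σ} (x₁ , x₂ , σx₁ , σx₂ , _ , inj₂ (S-meet , ρ⊆ , ⊆ρ)) =
    record { a = x₂ ; b = x₁ ; σa = σx₂ ; σb = σx₁ ; S-a∧b* = S-meet
           ; ρ⊆ = λ y ρy → replace-swap {σ} y (ρ⊆ y ρy)
           ; ⊆ρ = λ y my → ⊆ρ y (replace-swap {σ} y my) }

  ShrinkClosed : Subset 𝕌 → Subset 𝕌 → Set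
  ShrinkClosed S P = ∀ {a b} → P a → S (a ∧ b *) → P (a ∧ b *)

  ShrinkReflecting : Subset 𝕌 → Subset 𝕌 → Set
  ShrinkReflecting S P = ∀ {a b} → S a → S b → S (a ∧ b *) → P b → P (a ∧ b *) → P a

  StableOn : Subset 𝕌 → Subset 𝕌 → Set
  StableOn S P = ∀ y → S y → ¬ ¬ P y → P y

  shrinking-preserves : ∀ {S P} → ShrinkClosed S P →
                        ∀ {σ ρ} → Shrinking S σ ρ → σ ⊆ P → ρ ⊆ P
  shrinking-preserves closed sh σ⊆P y ρy with Shrinking.ρ⊆ sh y ρy
  ... | inj₁ (σy , _)    = σ⊆P y σy
  ... | inj₂ (inj₁ refl) = closed (σ⊆P _ (Shrinking.σa sh)) (Shrinking.S-a∧b* sh)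
  ... | inj₂ (inj₂ refl) = σ⊆P _ (Shrinking.σb sh)

  shrinking-⊆ : ∀ {S σ ρ} → Shrinking S σ ρ → σ ⊆ S → ρ ⊆ S
  shrinking-⊆ {S} = shrinking-preserves {S} {S} (λ _ S-a∧b* → S-a∧b*)

  uncrossing-preserves : ∀ {S P} → ShrinkClosed S P →
                         ∀ {σ τ} → Uncrosses 𝕌 S σ τ → σ ⊆ P → τ ⊆ P
  uncrossing-preserves closed (done (_ , τ⊆σ)) σ⊆P y τy = σ⊆P y (τ⊆σ y τy)
  uncrossing-preserves {S} closed (step σ→ρ ρ⇝τ) σ⊆P =
    uncrossing-preserves closed ρ⇝τ
      (shrinking-preserves closed (uncrossStep⇒shrinking {S} σ→ρ) σ⊆P)

  uncrossing-⊆ : ∀ {S σ τ} → Uncrosses 𝕌 S σ τ → σ ⊆ S → τ ⊆ S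
  uncrossing-⊆ {S} = uncrossing-preserves {S} {S} (λ _ S-a∧b* → S-a∧b*)

  shrinking-reflects : ∀ {S P} → StableOn S P → ShrinkReflecting S P →
                       ∀ {σ ρ} → Shrinking S σ ρ → σ ⊆ S → ρ ⊆ P → σ ⊆ P
  shrinking-reflects {P = P} stable reflecting sh σ⊆S ρ⊆P y σy =
    stable y (σ⊆S y σy) λ ¬Py → ¬Py (ρ⊆P y (⊆ρ y (inj₁ (σy , y≢ ¬Py Pa , y≢ ¬Py Pb))))
    where
    open Shrinking sh
    Pb : P b
    Pb = ρ⊆P b (⊆ρ b (inj₂ (inj₂ refl)))
    Pa : P a
    Pa = reflecting (σ⊆S a σa) (σ⊆S b σb) S-a∧b* Pb (ρ⊆P _ (⊆ρ _ (inj₂ (inj₁ refl))))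
    y≢ : ∀ {x} → ¬ P y → P x → ¬ y ≡ x
    y≢ ¬Py Px refl = ¬Py Px

  uncrossing-reflects : ∀ {S P} → StableOn S P → ShrinkReflecting S P →
                        ∀ {σ τ} → Uncrosses 𝕌 S σ τ → σ ⊆ S → τ ⊆ P → σ ⊆ P
  uncrossing-reflects _ _ (done (σ⊆τ , _)) _ τ⊆P y σy = τ⊆P y (σ⊆τ y σy)
  uncrossing-reflects {S} stable reflecting (step σ→ρ ρ⇝τ) σ⊆S τ⊆P =
    shrinking-reflects stable reflecting (uncrossStep⇒shrinking {S} σ→ρ) σ⊆S
      (uncrossing-reflects stable reflecting ρ⇝τ
        (shrinking-⊆ (uncrossStep⇒shrinking {S} σ→ρ) σ⊆S) τ⊆P)

  profileSet-⊆ : ∀ {P r s} → P r → P s → P (r * ∧ s *) → profileSet 𝕌 r s ⊆ P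
  profileSet-⊆ Pr _  _  _ (inj₁ refl)        = Pr
  profileSet-⊆ _  Ps _  _ (inj₂ (inj₁ refl)) = Ps
  profileSet-⊆ _  _  Pt _ (inj₂ (inj₂ refl)) = Pt

  module _ {S : Subset 𝕌} {F : Family 𝕌} (P⊆F : ContainsP 𝕌 S F)
           {O : Subset 𝕌} (avoids : Avoids 𝕌 F O) where

    profile⊈ : ∀ {r s} → S r → S s → S (r * ∧ s *) → O r → O s → O (r * ∧ s *) → ⊥
    profile⊈ {r} {s} Sr Ss St Or Os Ot with P⊆F r s (profileSet-⊆ Sr Ss St)
    ... | i , Fi⊆profile , _ = avoids i λ x Fix → profileSet-⊆ Or Os Ot x (Fi⊆profile x Fix)

    module _ (closed : ClosedUnder* 𝕌 S) where

      ¬both-orientations : ∀ {x} → S x → O x → O (x *) → ⊥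
      ¬both-orientations {x} Sx Ox Ox* =
        profile⊈ Sx Sx (subst S (sym (∧-idempotent (x *))) (closed x Sx))
          Ox Ox (subst O (sym (∧-idempotent (x *))) Ox*)

      -- {a*, b, a ∧ b*} is the profile of a* and b.
      avoiding-shrinkReflecting : IsOrientation 𝕌 S O → ShrinkReflecting S O
      avoiding-shrinkReflecting (_ , oriented , _) {a} {b} Sa Sb S-a∧b* Ob Oa∧b* with oriented a Sa
      ... | inj₁ Oa  = Oa
      ... | inj₂ Oa* = ⊥-elim (profile⊈ (closed a Sa) Sb (subst S a∧b*≡ S-a∧b*)
                                        Oa* Ob (subst O a∧b*≡ Oa∧b*))
        where
        a∧b*≡ : a ∧ b * ≡ (a *) * ∧ b *
        a∧b*≡ = cong (_∧ b *) (sym (involutive a))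

      avoiding-stableOn : IsOrientation 𝕌 S O → StableOn S O
      avoiding-stableOn (_ , oriented , _) y Sy ¬¬Oy with oriented y Sy
      ... | inj₁ Oy  = Oy
      ... | inj₂ Oy* = ⊥-elim (¬¬Oy λ Oy → ¬both-orientations Sy Oy Oy*)

  module _ {S O : Subset 𝕌} (orientation : IsOrientation 𝕌 S O) where

    star-stableOn : ∀ {τ} → IsStar 𝕌 τ → τ ⊆ S → StableOn τ O
    star-stableOn (nondegenerate , _) τ⊆S y τy ¬¬Oy with proj₁ (proj₂ orientation) y (τ⊆S y τy)
    ... | inj₁ Oy  = Oy
    ... | inj₂ Oy* = ⊥-elim (¬¬Oy λ Oy → nondegenerate y τy (proj₂ (proj₂ orientation) y Oy Oy*))

    module _ (consistent : Consistent 𝕌 O) (regular : Regular 𝕌 S O) where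

      -- Membership in O is not decidable, so down-closure holds only up to double negation.
      ¬¬downClosed : ∀ {z x} → S z → z ≤ x → O x → ¬ ¬ O z
      ¬¬downClosed {z} {x} Sz z≤x Ox ¬Oz with proj₁ (proj₂ orientation) z Sz
      ... | inj₁ Oz  = ¬Oz Oz
      ... | inj₂ Oz* = consistent z x z≤x z≢x z≢x* Oz* Ox
        where
        z≢x : ¬ z ≡ x
        z≢x refl = ¬Oz Ox
        z≢x* : ¬ z ≡ x *
        z≢x* refl = ¬Oz (regular z Sz (subst (x * ≤_) (sym (involutive x)) z≤x))

      ¬¬shrinkClosed : ShrinkClosed S (λ y → ¬ ¬ O y)
      ¬¬shrinkClosed {a} {b} ¬¬Oa S-a∧b* ¬Oa∧b* =
        ¬¬Oa λ Oa → ¬¬downClosed S-a∧b* (x∧y≤x a (b *)) Oa ¬Oa∧b*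

  module _ {S : Subset 𝕌} {F F* : Family 𝕌} (F⊆S : FamilyIn 𝕌 S F) {O : Subset 𝕌}
           (orientation : IsOrientation 𝕌 S O) where

    avoids⇒avoids-uncrossing : ClosedUnder* 𝕌 S → ContainsP 𝕌 S F →
      (∀ j → ∃[ i ] ObtainedByUncrossing 𝕌 S (mem F i) (mem F* j)) →
      Avoids 𝕌 F O → Avoids 𝕌 F* O
    avoids⇒avoids-uncrossing closed P⊆F uncrossedFrom avoids j τ⊆O with uncrossedFrom j
    ... | i , _ , σ⇝τ = avoids i (uncrossing-reflects
      (avoiding-stableOn P⊆F avoids closed orientation)
      (avoiding-shrinkReflecting P⊆F avoids closed orientation)
      σ⇝τ (F⊆S i) τ⊆O)

    avoids-uncrossing⇒avoids : Consistent 𝕌 O → Regular 𝕌 S O →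
      (∀ i → ∃[ j ] ObtainedByUncrossing 𝕌 S (mem F i) (mem F* j)) →
      Avoids 𝕌 F* O → Avoids 𝕌 F O
    avoids-uncrossing⇒avoids consistent regular uncrossesTo avoids* i σ⊆O with uncrossesTo i
    ... | j , τ-star , σ⇝τ = avoids* j λ y τy →
      star-stableOn orientation τ-star (uncrossing-⊆ σ⇝τ (F⊆S i)) y τy
        (uncrossing-preserves (¬¬shrinkClosed orientation consistent regular) σ⇝τ
          (λ y σy ¬Oy → ¬Oy (σ⊆O y σy)) y τy)

lemma3p5 : (𝕌 : Universe) (S : Subset 𝕌) →
           ClosedUnder* 𝕌 S → Submodular 𝕌 S →
           (F F* : Family 𝕌) →
           FamilyIn 𝕌 S F → ContainsP 𝕌 S F →
           IsUncrossingOf 𝕌 S F* F →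
           (O : Subset 𝕌) →
           RegularTangle 𝕌 S F O ⇔ RegularTangle 𝕌 S F* O
lemma3p5 𝕌 S closed _ F F* F⊆S P⊆F (uncrossedFrom , uncrossesTo) O = mk⇔
  (λ (orientation , consistent , avoids , regular) →
     orientation , consistent ,
     avoids⇒avoids-uncrossing 𝕌 F⊆S orientation closed P⊆F uncrossedFrom avoids , regular)
  (λ (orientation , consistent , avoids* , regular) →
     orientation , consistent ,
     avoids-uncrossing⇒avoids 𝕌 F⊆S orientation consistent regular uncrossesTo avoids* , regular)
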